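{- Let $f\in\mathscr{A}$ be a quaternary $\mathrm{EO}$ signature that is not identically zero. Then, up to reordering of variables, one of the following holds: (i) $|\mathrm{su}(f)|=1$ and $f=\lambda\,\Delta_0^{\otimes2}\otimes\Delta_1^{\otimes2}$ with $\lambda\neq0$; (ii) $|\mathrm{su}(f)|=2$ and either $f=\Delta_0\otimes\Delta_1\otimes\neq_2^{a,b}$ with $ab\neq0$ and $a/b\in\{\pm1,\pm\mathfrak{i}\}$, or $f=\neq_4^{a,b}$ with $ab\neq0$ and $a/b\in\{\pm1,\pm\mathfrak{i}\}$; (iii) $|\mathrm{su}(f)|=4$, and there exist distinct $\alpha,\beta$ with $\mathrm{su}(f)=\{\alpha,\overline{\alpha},\beta,\overline{\beta}\}$; moreover $f(x)/f(y)\in\{\pm1,\pm\mathfrak{i}\}$ for all $x,y\in\mathrm{su}(f)$, and $f(\alpha)f(\overline{\alpha})=\pm f(\beta)f(\overline{\beta})$.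
   Context: Signatures are functions $\{0,1\}^r\to\mathbb{C}$; $\mathrm{su}(f)$ is the set of inputs where $f\neq0$; $\overline\alpha$ denotes the bitwise complement of $\alpha$. An $\mathrm{EO}$ signature has even arity and support consisting only of strings with equally many 0's and 1's. $\Delta_0,\Delta_1$ are the unary signatures with $\Delta_0(0)=1,\Delta_0(1)=0$, $\Delta_1(0)=0,\Delta_1(1)=1$; $\otimes$ is the tensor product. A generalized disequality $\neq_{2d}^{a,b}$ is an $\mathrm{EO}$ signature of arity $2d$ with support contained in $\{\alpha,\overline\alpha\}$ for some $\alpha$ with $d$ zeros and $d$ ones, value $a$ at $\alpha$ and $b$ at $\overline\alpha$. $\mathfrak{i}=\sqrt{ -1}$. $\mathscr{A}$ is the set of signatures of the form $\lambda\cdot\chi_{AX}\cdot \mathfrak{i}^{L_1(X)+\cdots+L_n(X)}$, where $X=(x_1,\dots,x_d,1)^T$, $A$ is a matrix over $\mathbb{F}_2$, $\chi_{AX}=1$ iff $AX=0$ over $\mathbb{F}_2$ (and $0$ otherwise), $\lambda\in\mathbb{C}$, and each $L_j(X)\in\{0,1\}$ is the $\mathbb{F}_2$-inner product $\langle\alpha_j,X\rangle$ for some $\alpha_j\in\mathbb{F}_2^{d+1}$, the exponent being summed over the integers. -}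

module Defs where

open import Level using (Level; _⊔_)
open import Algebra.Bundles using (CommutativeRing)
open import Data.Bool using (Bool; true; false; not; _∧_; _xor_; if_then_else_)
open import Data.Nat as ℕ using (ℕ; zero; suc)
open import Data.Fin using (Fin)
open import Data.Fin.Permutation using (Permutation′; _⟨$⟩ʳ_)
open import Data.Vec using (Vec; []; _∷_; _++_; map; lookup; tabulate; count)
open import Data.List using (List; length)
open import Data.List.Membership.Propositional using (_∈_)
open import Data.List.Relation.Unary.Unique.Propositional using (Unique)
open import Data.Product using (Σ; ∃; ∃-syntax; _×_; _,_)
open import Data.Sum using (_⊎_)
open import Relation.Nullary using (¬_)
open import Relation.Binary.PropositionalEquality using (_≡_; _≢_)
open import Function.Bundles using (_⇔_)

Bits : ℕ → Set
Bits r = Vec Bool r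

comp : ∀ {r} → Bits r → Bits r
comp = map not

ones zeros : ∀ {r} → Bits r → ℕ
ones = count (λ b → Data.Bool._≟_ b true)
  where import Data.Bool
zeros = count (λ b → Data.Bool._≟_ b false)
  where import Data.Bool

dot : ∀ {k} → Bits k → Bits k → Bool
dot [] [] = false
dot (a ∷ as) (b ∷ bs) = (a ∧ b) xor dot as bs

extend : ∀ {d} → Bits d → Bits (suc d)
extend {d} x = Data.Vec._∷ʳ_ x true
  where import Data.Vec

permuteBits : ∀ {r} → Permutation′ r → Bits r → Bits r
permuteBits π x = tabulate (λ k → lookup x (π ⟨$⟩ʳ k))

allZero : ∀ {m k} → Vec (Bits k) m → Bits k → Bool
allZero [] X = true
allZero (row ∷ A) X = not (dot row X) ∧ allZero A X

expSum : ∀ {n k} → Vec (Bits k) n → Bits k → ℕ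
expSum [] X = 0
expSum (a ∷ as) X = (if dot a X then 1 else 0) ℕ.+ expSum as X

-- Signatures with values in a commutative ring R (intended: ℂ), with a
-- distinguished element i satisfying i * i ≈ - 1.
module Sig {c ℓ : Level} (R : CommutativeRing c ℓ) (i : CommutativeRing.Carrier R) where
  open CommutativeRing R

  Signature : ℕ → Set c
  Signature r = Bits r → Carrier

  ipow : ℕ → Carrier
  ipow zero = 1#
  ipow (suc k) = i * ipow k

  boolVal : Bool → Carrier
  boolVal b = if b then 1# else 0#

  InA : ∀ {d} → Signature d → Set (c ⊔ ℓ)
  InA {d} f = ∃[ lam ] ∃[ m ] ∃[ n ] Σ (Vec (Bits (suc d)) m) λ A → Σ (Vec (Bits (suc d)) n) λ αs →
    ∀ x → f x ≈ lam * (boolVal (allZero A (extend x)) * ipow (expSum αs (extend x)))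

  -- EO signature (even arity handled by the caller): support only on balanced strings
  IsEO : ∀ {r} → Signature r → Set ℓ
  IsEO f = ∀ x → ¬ (f x ≈ 0#) → ones x ≡ zeros x

  InSu : ∀ {r} → Signature r → Bits r → Set ℓ
  InSu f x = ¬ (f x ≈ 0#)

  SuCard : ∀ {r} → Signature r → ℕ → Set ℓ
  SuCard {r} f k = Σ (List (Bits r)) λ L → length L ≡ k × Unique L × (∀ x → InSu f x ⇔ x ∈ L)

  reorder : ∀ {r} → Permutation′ r → Signature r → Signature r
  reorder π f x = f (permuteBits π x)

  Δ₀ Δ₁ : Bool → Carrier
  Δ₀ b = if b then 0# else 1#
  Δ₁ b = if b then 1# else 0#

  IsUnitPow : Carrier → Set ℓ
  IsUnitPow u = (u ≈ 1#) ⊎ (u ≈ - 1#) ⊎ (u ≈ i) ⊎ (u ≈ - i)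

  -- a / b ∈ {±1, ±i}   (for b ≠ 0)
  RatioIn : Carrier → Carrier → Set (c ⊔ ℓ)
  RatioIn a b = ∃[ u ] IsUnitPow u × a ≈ u * b

  GenDiseq : (d : ℕ) → Carrier → Carrier → Signature (d ℕ.+ d) → Set ℓ
  GenDiseq d a b h = ∃[ α ] ones α ≡ d × zeros α ≡ d × h α ≈ a × h (comp α) ≈ b ×
    (∀ y → y ≢ α → y ≢ comp α → h y ≈ 0#)

  Case1 : Signature 4 → Set (c ⊔ ℓ)
  Case1 g = SuCard g 1 × ∃[ lam ] ¬ (lam ≈ 0#) ×
    (∀ x₁ x₂ x₃ x₄ → g (x₁ ∷ x₂ ∷ x₃ ∷ x₄ ∷ []) ≈ lam * (Δ₀ x₁ * (Δ₀ x₂ * (Δ₁ x₃ * Δ₁ x₄))))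

  Case2 : Signature 4 → Set (c ⊔ ℓ)
  Case2 g = SuCard g 2 × ∃[ a ] ∃[ b ] ¬ (a * b ≈ 0#) × RatioIn a b ×
    ( (Σ (Signature 2) λ h → GenDiseq 1 a b h ×
         (∀ x₁ x₂ x₃ x₄ → g (x₁ ∷ x₂ ∷ x₃ ∷ x₄ ∷ []) ≈ Δ₀ x₁ * (Δ₁ x₂ * h (x₃ ∷ x₄ ∷ []))))
    ⊎ GenDiseq 2 a b g )

  Case3 : Signature 4 → Set (c ⊔ ℓ)
  Case3 g = SuCard g 4 × ∃[ α ] ∃[ β ] α ≢ β ×
    (∀ x → InSu g x ⇔ (x ≡ α ⊎ x ≡ comp α ⊎ x ≡ β ⊎ x ≡ comp β)) ×
    (∀ x y → InSu g x → InSu g y → RatioIn (g x) (g y)) ×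
    ((g α * g (comp α) ≈ g β * g (comp β)) ⊎ (g α * g (comp α) ≈ - (g β * g (comp β))))

{-# OPTIONS --safe #-}

-- Write f = λ · χ_S · i^k with S = {x | A (x,1) = 0} and k x = Σⱼ Lⱼ (x,1). Since A is linear,
-- S is closed under (a, b, c) ↦ a ⊕ b ⊕ c, and since f is EO it lies among the six strings of
-- weight 2. Up to reordering the variables the only nonempty such sets are a single string, two
-- non-complementary strings, one complementary pair and two complementary pairs, giving cases
-- (i), (ii), (ii) and (iii). On S every value is λ times a power of i, whence the ratios in
-- {±1, ±i}. Finally k mod 2 is a linear function of (x,1), and α ⊕ ᾱ = β ⊕ β̄, so
-- k α + k ᾱ ≡ k β + k β̄ (mod 2), that is f(α) f(ᾱ) = ± f(β) f(β̄).

module Submission where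

open import Defs
open import Algebra.Bundles using (CommutativeRing)
open import Data.Vec using (Vec)
open import Data.Fin.Permutation using (Permutation′)
open import Data.Product using (∃-syntax; _×_)
open import Data.Sum using (_⊎_)
open import Relation.Nullary using (¬_)

import Algebra.Properties.CommutativeSemigroup as CommutativeSemigroupProperties
import Algebra.Properties.Ring as RingProperties
open import Data.Bool as Bool using (Bool; true; false; not; _∧_; _xor_; if_then_else_)
open import Data.Bool.Properties using (xor-∧-commutativeRing; ∧-distribˡ-xor; xor-inverseʳ)
open import Data.Empty using (⊥-elim)
open import Data.Fin using (zero)
open import Data.Fin.Permutation using (id; transpose; lift₀; _∘ₚ_; _⟨$⟩ʳ_)
open import Data.Fin.Subset.Properties using (anySubset?)
open import Data.List as List using (List; []; _∷_; length; concatMap; allFin; cartesianProduct)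
open import Data.List.Membership.Propositional using (_∈_)
open import Data.List.Relation.Unary.Any using (Any; here; there; any?; satisfied)
open import Data.List.Relation.Unary.Unique.Propositional using (Unique)
open import Data.List.Relation.Unary.Unique.DecPropositional using (unique?)
open import Data.Nat as ℕ using (ℕ; zero; suc; parity)
import Data.Nat.Properties as ℕ
open import Data.Parity as ℙ using (0ℙ)
import Data.Parity.Properties as ℙ
open import Data.Product using (∃; _,_; proj₁; proj₂)
open import Data.Sum using (inj₁; inj₂)
open import Data.Vec using ([]; _∷_; _∷ʳ_; map; replicate; zipWith; lookup)
open import Data.Vec.Properties using (≡-dec; lookup-map; tabulate-∘; tabulate-cong)
import Data.Vec.Membership.DecPropositional as VecMembership
open import Data.Vec.Membership.Propositional using () renaming (_∈_ to _∈ᵥ_)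
import Data.Vec.Relation.Unary.All as VecAll
import Data.Vec.Relation.Unary.Any as VecAny
open import Function.Base using (_∘_)
open import Function.Bundles using (_⇔_; mk⇔; Equivalence)
open import Function.Construct.Composition using (_⇔-∘_)
open import Relation.Binary.Definitions using (DecidableEquality)
open import Relation.Binary.PropositionalEquality
  using (_≡_; _≢_; _≗_; refl; sym; trans; cong; cong₂; subst; module ≡-Reasoning)
open import Relation.Nullary using (Dec; yes; no; does; ¬?; _→-dec_)
open import Relation.Nullary.Decidable using (map′; from-yes; decidable-stable; dec-true; dec-false)
open import Relation.Unary using (Decidable)

-- Bit strings as vectors over F₂

infix 4 _≟_
_≟_ : ∀ {n} → DecidableEquality (Bits n)
_≟_ = ≡-dec Bool._≟_

open import Data.List.Membership.DecPropositional (_≟_ {4}) using (_∈?_)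

infixl 6 _⊕_
_⊕_ : ∀ {n} → Bits n → Bits n → Bits n
_⊕_ = zipWith _xor_

all-Bits? : ∀ {n p} {P : Bits n → Set p} → Decidable P → Dec (∀ x → P x)
all-Bits? P? = map′ (λ ∄¬P x → decidable-stable (P? x) (λ ¬Px → ∄¬P (x , ¬Px)))
                    (λ ∀P (x , ¬Px) → ¬Px (∀P x))
                    (¬? (anySubset? (¬? ∘ P?)))

open CommutativeSemigroupProperties (CommutativeRing.+-commutativeSemigroup xor-∧-commutativeRing)
  using () renaming (interchange to xor-interchange)
open CommutativeSemigroupProperties ℙ.+-commutativeSemigroup
  using () renaming (interchange to ℙ+-interchange)

⊕-∷ʳ : ∀ {n} (x y : Bits n) a b → (x ∷ʳ a) ⊕ (y ∷ʳ b) ≡ (x ⊕ y) ∷ʳ (a xor b)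
⊕-∷ʳ []      []      a b = refl
⊕-∷ʳ (u ∷ x) (v ∷ y) a b = cong ((u xor v) ∷_) (⊕-∷ʳ x y a b)

⊕-comp : ∀ {n} (x : Bits n) → x ⊕ comp x ≡ replicate n true
⊕-comp []      = refl
⊕-comp (u ∷ x) = cong₂ _∷_ (xor-inverseʳ u) (⊕-comp x)

extend-⊕₃ : ∀ {d} (a b c : Bits d) → extend a ⊕ extend b ⊕ extend c ≡ extend (a ⊕ b ⊕ c)
extend-⊕₃ a b c = trans (cong (_⊕ extend c) (⊕-∷ʳ a b true true)) (⊕-∷ʳ (a ⊕ b) c false true)

extend-⊕-comp : ∀ {d} (x : Bits d) → extend x ⊕ extend (comp x) ≡ replicate d true ∷ʳ false
extend-⊕-comp x = trans (⊕-∷ʳ x (comp x) true true) (cong (_∷ʳ false) (⊕-comp x))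

dot-⊕ : ∀ {k} (r X Y : Bits k) → dot r (X ⊕ Y) ≡ dot r X xor dot r Y
dot-⊕ []       []      []      = refl
dot-⊕ (r ∷ rs) (x ∷ X) (y ∷ Y) = begin
  (r ∧ (x xor y)) xor dot rs (X ⊕ Y)
    ≡⟨ cong₂ _xor_ (∧-distribˡ-xor r x y) (dot-⊕ rs X Y) ⟩
  ((r ∧ x) xor (r ∧ y)) xor (dot rs X xor dot rs Y)
    ≡⟨ xor-interchange (r ∧ x) (r ∧ y) (dot rs X) (dot rs Y) ⟩
  ((r ∧ x) xor dot rs X) xor ((r ∧ y) xor dot rs Y) ∎
  where open ≡-Reasoning

allZero-⊕ : ∀ {m k} (A : Vec (Bits k) m) {X Y : Bits k} →
            allZero A X ≡ true → allZero A Y ≡ true → allZero A (X ⊕ Y) ≡ true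
allZero-⊕ []      _  _  = refl
allZero-⊕ (r ∷ A) {X} {Y} AX AY with dot r X in rX | dot r Y in rY
allZero-⊕ (r ∷ A) {X} {Y} AX AY | false | false
  rewrite dot-⊕ r X Y | rX | rY = allZero-⊕ A AX AY
allZero-⊕ (r ∷ A) () AY | true  | _
allZero-⊕ (r ∷ A) AX () | false | true

allZero-extend-⊕₃ : ∀ {m d} (A : Vec (Bits (suc d)) m) (a b c : Bits d) →
  allZero A (extend a) ≡ true → allZero A (extend b) ≡ true → allZero A (extend c) ≡ true →
  allZero A (extend (a ⊕ b ⊕ c)) ≡ true
allZero-extend-⊕₃ A a b c Aa Ab Ac =
  subst (λ X → allZero A X ≡ true) (extend-⊕₃ a b c) (allZero-⊕ A (allZero-⊕ A Aa Ab) Ac)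

parity-expSum-⊕ : ∀ {n k} (αs : Vec (Bits k) n) (X Y : Bits k) →
  parity (expSum αs (X ⊕ Y)) ≡ parity (expSum αs X) ℙ.+ parity (expSum αs Y)
parity-expSum-⊕ []       X Y = refl
parity-expSum-⊕ (a ∷ αs) X Y = begin
  parity (bit (dot a (X ⊕ Y)) ℕ.+ expSum αs (X ⊕ Y))
    ≡⟨ ℙ.+-homo-+ (bit (dot a (X ⊕ Y))) (expSum αs (X ⊕ Y)) ⟩
  parity (bit (dot a (X ⊕ Y))) ℙ.+ parity (expSum αs (X ⊕ Y))
    ≡⟨ cong₂ ℙ._+_ (trans (cong (parity ∘ bit) (dot-⊕ a X Y)) (parity-bit-xor (dot a X) (dot a Y)))
                   (parity-expSum-⊕ αs X Y) ⟩
  (parity (bit (dot a X)) ℙ.+ parity (bit (dot a Y))) ℙ.+ (parity (expSum αs X) ℙ.+ parity (expSum αs Y))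
    ≡⟨ ℙ+-interchange (parity (bit (dot a X))) _ _ _ ⟩
  (parity (bit (dot a X)) ℙ.+ parity (expSum αs X)) ℙ.+ (parity (bit (dot a Y)) ℙ.+ parity (expSum αs Y))
    ≡⟨ cong₂ ℙ._+_ (ℙ.+-homo-+ (bit (dot a X)) _) (ℙ.+-homo-+ (bit (dot a Y)) _) ⟨
  parity (expSum (a ∷ αs) X) ℙ.+ parity (expSum (a ∷ αs) Y) ∎
  where
  open ≡-Reasoning
  bit : Bool → ℕ
  bit b = if b then 1 else 0
  parity-bit-xor : ∀ u v → parity (bit (u xor v)) ≡ parity (bit u) ℙ.+ parity (bit v)
  parity-bit-xor false v     = refl
  parity-bit-xor true  false = refl
  parity-bit-xor true  true  = refl

parity-expSum-comp : ∀ {n d} (αs : Vec (Bits (suc d)) n) (x : Bits d) →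
  parity (expSum αs (extend x) ℕ.+ expSum αs (extend (comp x))) ≡ parity (expSum αs (replicate d true ∷ʳ false))
parity-expSum-comp αs x = begin
  parity (expSum αs (extend x) ℕ.+ expSum αs (extend (comp x)))
    ≡⟨ ℙ.+-homo-+ (expSum αs (extend x)) _ ⟩
  parity (expSum αs (extend x)) ℙ.+ parity (expSum αs (extend (comp x)))
    ≡⟨ parity-expSum-⊕ αs (extend x) (extend (comp x)) ⟨
  parity (expSum αs (extend x ⊕ extend (comp x)))
    ≡⟨ cong (parity ∘ expSum αs) (extend-⊕-comp x) ⟩
  parity (expSum αs (replicate _ true ∷ʳ false)) ∎
  where open ≡-Reasoning

permuteBits-comp : ∀ {r} (π : Permutation′ r) (x : Bits r) → permuteBits π (comp x) ≡ comp (permuteBits π x)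
permuteBits-comp π x =
  trans (tabulate-cong (λ k → lookup-map (π ⟨$⟩ʳ k) not x)) (tabulate-∘ not (λ k → lookup x (π ⟨$⟩ʳ k)))

ComplementParity : ∀ {r} → (Bits r → ℕ) → Set
ComplementParity k = ∀ x y → parity (k x ℕ.+ k (comp x)) ≡ parity (k y ℕ.+ k (comp y))

complementParity-expSum : ∀ {n d} (αs : Vec (Bits (suc d)) n) (π : Permutation′ d) →
                          ComplementParity (expSum αs ∘ extend ∘ permuteBits π)
complementParity-expSum αs π x y = trans (atComp x) (sym (atComp y))
  where
  atComp : ∀ x → parity (expSum αs (extend (permuteBits π x)) ℕ.+ expSum αs (extend (permuteBits π (comp x))))
                 ≡ parity (expSum αs (replicate _ true ∷ʳ false))
  atComp x = trans (cong (λ z → parity (expSum αs (extend (permuteBits π x)) ℕ.+ expSum αs (extend z)))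
                         (permuteBits-comp π x))
                   (parity-expSum-comp αs (permuteBits π x))

-- Classification of the possible supports

b0011 b0101 b0110 b1001 b1010 b1100 : Bits 4
b0011 = false ∷ false ∷ true  ∷ true  ∷ []
b0101 = false ∷ true  ∷ false ∷ true  ∷ []
b0110 = false ∷ true  ∷ true  ∷ false ∷ []
b1001 = true  ∷ false ∷ false ∷ true  ∷ []
b1010 = true  ∷ false ∷ true  ∷ false ∷ []
b1100 = true  ∷ true  ∷ false ∷ false ∷ []

balanced : Vec (Bits 4) 6
balanced = b0011 ∷ b0101 ∷ b0110 ∷ b1001 ∷ b1010 ∷ b1100 ∷ []

balanced-complete : ∀ x → ones x ≡ zeros x → x ∈ᵥ balanced
balanced-complete = from-yes (all-Bits? λ x → (ones x ℕ.≟ zeros x) →-dec (x ∈ᵥ? balanced))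
  where open VecMembership _≟_ using () renaming (_∈?_ to _∈ᵥ?_)

lookupMask : ∀ {n r} → Vec Bool n → Vec (Bits r) n → Bits r → Bool
lookupMask []      []       x = false
lookupMask (t ∷ τ) (b ∷ bs) x = if does (x ≟ b) then t else lookupMask τ bs x

lookupMask-map : ∀ {n r} (s : Bits r → Bool) (bs : Vec (Bits r) n) x →
                 (s x ≡ true → x ∈ᵥ bs) → lookupMask (map s bs) bs x ≡ s x
lookupMask-map s []       x x∈ with s x | x∈
... | false | _ = refl
... | true  | x∈[] with () ← x∈[] refl
lookupMask-map s (b ∷ bs) x x∈ with x ≟ b
... | yes refl = refl
... | no  x≢b  = lookupMask-map s bs x λ sx → ∈-tail (x∈ sx)
  where
  ∈-tail : x ∈ᵥ (b ∷ bs) → x ∈ᵥ bs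
  ∈-tail (VecAny.here x≡b) = ⊥-elim (x≢b x≡b)
  ∈-tail (VecAny.there x∈bs) = x∈bs

AffineAt : ∀ {r} → (Bits r → Bool) → Bits r → Bits r → Bits r → Set
AffineAt s a b c = s a ≡ true → s b ≡ true → s c ≡ true → s (a ⊕ b ⊕ c) ≡ true

Affine : ∀ {r} → (Bits r → Bool) → Set
Affine s = ∀ a b c → AffineAt s a b c

AffineOn : ∀ {n r} → Vec (Bits r) n → (Bits r → Bool) → Set
AffineOn xs s = VecAll.All (λ a → VecAll.All (λ b → VecAll.All (AffineAt s a b) xs) xs) xs

affineOn? : ∀ {n r} (xs : Vec (Bits r) n) s → Dec (AffineOn xs s)
affineOn? xs s = VecAll.all? (λ a → VecAll.all? (λ b → VecAll.all? (λ c →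
  (s a Bool.≟ true) →-dec (s b Bool.≟ true) →-dec (s c Bool.≟ true) →-dec (s (a ⊕ b ⊕ c) Bool.≟ true)) xs) xs) xs

Affine-resp-≗ : ∀ {r} {s t : Bits r → Bool} → s ≗ t → Affine s → Affine t
Affine-resp-≗ s≗t affine a b c ta tb tc =
  trans (sym (s≗t _)) (affine a b c (trans (s≗t a) ta) (trans (s≗t b) tb) (trans (s≗t c) tc))

Affine⇒AffineOn : ∀ {n r} {s : Bits r → Bool} (xs : Vec (Bits r) n) → Affine s → AffineOn xs s
Affine⇒AffineOn xs affine =
  VecAll.universal (λ a → VecAll.universal (λ b → VecAll.universal (affine a b) xs) xs) xs

Empty : ∀ {r} → (Bits r → Bool) → Set
Empty s = ∀ x → s x ≡ false

data Shape : Set where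
  singleton pinnedPair complementPair twoComplementPairs : Shape

shapeSupport : Shape → List (Bits 4)
shapeSupport singleton          = b0011 ∷ []
shapeSupport pinnedPair         = b0101 ∷ b0110 ∷ []
shapeSupport complementPair     = b0011 ∷ b1100 ∷ []
shapeSupport twoComplementPairs = b0011 ∷ b1100 ∷ b0101 ∷ b1010 ∷ []

shapeSupport-unique : ∀ sh → Unique (shapeSupport sh)
shapeSupport-unique singleton          = from-yes (unique? _≟_ (shapeSupport singleton))
shapeSupport-unique pinnedPair         = from-yes (unique? _≟_ (shapeSupport pinnedPair))
shapeSupport-unique complementPair     = from-yes (unique? _≟_ (shapeSupport complementPair))
shapeSupport-unique twoComplementPairs = from-yes (unique? _≟_ (shapeSupport twoComplementPairs))

inShape : Shape → Bits 4 → Bool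
inShape sh x = does (x ∈? shapeSupport sh)

∈-four : ∀ {A : Set} {x a b c d : A} →
         x ∈ a ∷ b ∷ c ∷ d ∷ [] ⇔ (x ≡ a ⊎ x ≡ b ⊎ x ≡ c ⊎ x ≡ d)
∈-four = mk⇔
  (λ { (here e)                         → inj₁ e
     ; (there (here e))                 → inj₂ (inj₁ e)
     ; (there (there (here e)))         → inj₂ (inj₂ (inj₁ e))
     ; (there (there (there (here e)))) → inj₂ (inj₂ (inj₂ e)) })
  (λ { (inj₁ e)                → here e
     ; (inj₂ (inj₁ e))         → there (here e)
     ; (inj₂ (inj₂ (inj₁ e)))  → there (there (here e))
     ; (inj₂ (inj₂ (inj₂ e)))  → there (there (there (here e))) })

Normalises : (Bits 4 → Bool) → Permutation′ 4 × Shape → Set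
Normalises s (π , sh) = ∀ x → s (permuteBits π x) ≡ inShape sh x

allPermutations : ∀ n → List (Permutation′ n)
allPermutations zero    = id ∷ []
allPermutations (suc n) =
  concatMap (λ j → List.map (λ σ → lift₀ σ ∘ₚ transpose zero j) (allPermutations n)) (allFin (suc n))

candidates : List (Permutation′ 4 × Shape)
candidates = cartesianProduct (allPermutations 4)
  (singleton ∷ pinnedPair ∷ complementPair ∷ twoComplementPairs ∷ [])

-- Checked by evaluation over all 2⁶ subsets of the balanced strings; opaque so that it is never
-- re-evaluated where it is used. The search only has to succeed, so allPermutations is never
-- shown to list every permutation.
opaque
  classification : ∀ (τ : Bits 6) → let s = lookupMask τ balanced in
                   AffineOn balanced s → ¬ Empty s → Any (Normalises s) candidates
  classification = from-yes (all-Bits? λ τ → let s = lookupMask τ balanced in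
    affineOn? balanced s →-dec ¬? (all-Bits? λ x → s x Bool.≟ false) →-dec
    any? (λ (π , sh) → all-Bits? λ x → s (permuteBits π x) Bool.≟ inShape sh x) candidates)

normalForm : (s : Bits 4 → Bool) → (∀ x → s x ≡ true → ones x ≡ zeros x) → Affine s → ¬ Empty s →
             ∃ (Normalises s)
normalForm s balanced-support affine nonempty = transport (satisfied (classification τ affineOn nonempty′))
  where
  τ = map s balanced
  s≗t : s ≗ lookupMask τ balanced
  s≗t x = sym (lookupMask-map s balanced x (balanced-complete x ∘ balanced-support x))
  affineOn : AffineOn balanced (lookupMask τ balanced)
  affineOn = Affine⇒AffineOn balanced (Affine-resp-≗ s≗t affine)
  nonempty′ : ¬ Empty (lookupMask τ balanced)
  nonempty′ empty = nonempty λ x → trans (s≗t x) (empty x)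
  transport : ∃ (Normalises (lookupMask τ balanced)) → ∃ (Normalises s)
  transport ((π , sh) , normal) = (π , sh) , λ x → trans (s≗t (permuteBits π x)) (normal x)

-- Values of signatures in 𝒜

module _ {c ℓ} (R : CommutativeRing c ℓ) where
  open CommutativeRing R hiding (refl; sym; trans)

  *-nonzero : (∀ x → ¬ x ≈ 0# → ∃[ y ] x * y ≈ 1#) → ∀ {x y} → ¬ x ≈ 0# → ¬ y ≈ 0# → ¬ x * y ≈ 0#
  *-nonzero inverse {x} {y} x≉0 y≉0 xy≈0 with inverse x x≉0
  ... | x⁻¹ , xx⁻¹≈1 = y≉0 (begin
    y               ≈⟨ *-identityˡ y ⟨
    1# * y          ≈⟨ *-congʳ xx⁻¹≈1 ⟨
    (x * x⁻¹) * y   ≈⟨ xy∙z≈y∙xz x x⁻¹ y ⟩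
    x⁻¹ * (x * y)   ≈⟨ *-congˡ xy≈0 ⟩
    x⁻¹ * 0#        ≈⟨ zeroʳ x⁻¹ ⟩
    0#              ∎)
    where
    open import Relation.Binary.Reasoning.Setoid setoid
    open CommutativeSemigroupProperties *-commutativeSemigroup using (xy∙z≈y∙xz)

module SignatureFacts {c ℓ} (R : CommutativeRing c ℓ) (i : CommutativeRing.Carrier R) where
  open CommutativeRing R hiding (refl; sym; trans)
  open CommutativeRing R using () renaming (refl to ≈-refl; sym to ≈-sym; trans to ≈-trans)
  open Sig R i
  open RingProperties ring using (-‿involutive; -‿distribʳ-*; -1*x≈-x)
  open CommutativeSemigroupProperties *-commutativeSemigroup using (x∙yz≈y∙xz; interchange)
  open import Relation.Binary.Reasoning.Setoid setoid

  infix 4 _≈±_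
  _≈±_ : Carrier → Carrier → Set ℓ
  x ≈± y = x ≈ y ⊎ x ≈ - y

  ≈±-resp : ∀ {x x′ y y′} → x ≈ x′ → y ≈ y′ → x′ ≈± y′ → x ≈± y
  ≈±-resp x≈x′ y≈y′ (inj₁ e) = inj₁ (≈-trans x≈x′ (≈-trans e (≈-sym y≈y′)))
  ≈±-resp x≈x′ y≈y′ (inj₂ e) = inj₂ (≈-trans x≈x′ (≈-trans e (-‿cong (≈-sym y≈y′))))

  *-congˡ-≈± : ∀ z {x y} → x ≈± y → z * x ≈± z * y
  *-congˡ-≈± z (inj₁ e) = inj₁ (*-congˡ e)
  *-congˡ-≈± z (inj₂ e) = inj₂ (≈-trans (*-congˡ e) (≈-sym (-‿distribʳ-* z _)))

  ≈±1-scale : ∀ {u} y → u ≈± 1# → u * y ≈± y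
  ≈±1-scale y (inj₁ e) = inj₁ (≈-trans (*-congʳ e) (*-identityˡ y))
  ≈±1-scale y (inj₂ e) = inj₂ (≈-trans (*-congʳ e) (-1*x≈-x y))

  ipow-+ : ∀ m n → ipow (m ℕ.+ n) ≈ ipow m * ipow n
  ipow-+ zero    n = ≈-sym (*-identityˡ (ipow n))
  ipow-+ (suc m) n = ≈-trans (*-congˡ (ipow-+ m n)) (≈-sym (*-assoc i (ipow m) (ipow n)))

  HasForm : ∀ {r} → Signature r → Carrier → (Bits r → Bool) → (Bits r → ℕ) → Set ℓ
  HasForm g lam σ k = ∀ x → g x ≈ lam * (boolVal (σ x) * ipow (k x))

  HasForm-resp-≗ : ∀ {r} {g : Signature r} {lam σ τ k} → σ ≗ τ → HasForm g lam σ k → HasForm g lam τ k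
  HasForm-resp-≗ {g = g} {lam} {k = k} σ≗τ g≈ x =
    subst (λ b → g x ≈ lam * (boolVal b * ipow (k x))) (σ≗τ x) (g≈ x)

  module Powers (i*i≈-1 : i * i ≈ - 1#) where

    i*[i*x]≈-x : ∀ x → i * (i * x) ≈ - x
    i*[i*x]≈-x x = ≈-trans (≈-sym (*-assoc i i x)) (≈-trans (*-congʳ i*i≈-1) (-1*x≈-x x))

    ipow-*4 : ∀ n → ipow (n ℕ.* 4) ≈ 1#
    ipow-*4 zero    = ≈-refl
    ipow-*4 (suc n) = begin
      i * (i * (i * (i * ipow (n ℕ.* 4)))) ≈⟨ i*[i*x]≈-x _ ⟩
      - (i * (i * ipow (n ℕ.* 4)))         ≈⟨ -‿cong (i*[i*x]≈-x _) ⟩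
      - - ipow (n ℕ.* 4)                   ≈⟨ -‿involutive _ ⟩
      ipow (n ℕ.* 4)                       ≈⟨ ipow-*4 n ⟩
      1#                                   ∎

    ipow-nonzero : ¬ 1# ≈ 0# → ∀ n → ¬ ipow n ≈ 0#
    ipow-nonzero 1≉0 n iⁿ≈0 = 1≉0 (begin
      1#                        ≈⟨ ipow-*4 n ⟨
      ipow (n ℕ.* 4)            ≡⟨ cong ipow (ℕ.*-suc n 3) ⟩
      ipow (n ℕ.+ n ℕ.* 3)      ≈⟨ ipow-+ n (n ℕ.* 3) ⟩
      ipow n * ipow (n ℕ.* 3)   ≈⟨ *-congʳ iⁿ≈0 ⟩
      0# * ipow (n ℕ.* 3)       ≈⟨ zeroˡ _ ⟩
      0#                        ∎)

    ipow-isUnitPow : ∀ n → IsUnitPow (ipow n)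
    ipow-isUnitPow zero = inj₁ ≈-refl
    ipow-isUnitPow (suc n) with ipow-isUnitPow n
    ... | inj₁ e               = inj₂ (inj₂ (inj₁ (≈-trans (*-congˡ e) (*-identityʳ i))))
    ... | inj₂ (inj₁ e)        = inj₂ (inj₂ (inj₂ (≈-trans (*-congˡ e)
                                   (≈-trans (≈-sym (-‿distribʳ-* i 1#)) (-‿cong (*-identityʳ i))))))
    ... | inj₂ (inj₂ (inj₁ e)) = inj₂ (inj₁ (≈-trans (*-congˡ e) i*i≈-1))
    ... | inj₂ (inj₂ (inj₂ e)) = inj₁ (≈-trans (*-congˡ e)
                                   (≈-trans (≈-sym (-‿distribʳ-* i i)) (≈-trans (-‿cong i*i≈-1) (-‿involutive 1#))))

    ipow-ratio : ∀ m n → ipow m ≈ ipow (m ℕ.+ n ℕ.* 3) * ipow n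
    ipow-ratio m n = begin
      ipow m                          ≈⟨ *-identityʳ _ ⟨
      ipow m * 1#                     ≈⟨ *-congˡ (ipow-*4 n) ⟨
      ipow m * ipow (n ℕ.* 4)         ≈⟨ ipow-+ m (n ℕ.* 4) ⟨
      ipow (m ℕ.+ n ℕ.* 4)            ≡⟨ cong (λ j → ipow (m ℕ.+ j)) (trans (ℕ.*-suc n 3) (ℕ.+-comm n (n ℕ.* 3))) ⟩
      ipow (m ℕ.+ (n ℕ.* 3 ℕ.+ n))    ≡⟨ cong ipow (ℕ.+-assoc m (n ℕ.* 3) n) ⟨
      ipow (m ℕ.+ n ℕ.* 3 ℕ.+ n)      ≈⟨ ipow-+ (m ℕ.+ n ℕ.* 3) n ⟩
      ipow (m ℕ.+ n ℕ.* 3) * ipow n   ∎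

    ratioIn-ipow : ∀ lam m n → RatioIn (lam * ipow m) (lam * ipow n)
    ratioIn-ipow lam m n = ipow (m ℕ.+ n ℕ.* 3) , ipow-isUnitPow (m ℕ.+ n ℕ.* 3) , (begin
      lam * ipow m                          ≈⟨ *-congˡ (ipow-ratio m n) ⟩
      lam * (ipow (m ℕ.+ n ℕ.* 3) * ipow n) ≈⟨ x∙yz≈y∙xz lam _ _ ⟩
      ipow (m ℕ.+ n ℕ.* 3) * (lam * ipow n) ∎)

    ipow-even : ∀ n → parity n ≡ 0ℙ → ipow n ≈± 1#
    ipow-even zero          _ = inj₁ ≈-refl
    ipow-even (suc (suc n)) p with ipow-even n p
    ... | inj₁ e = inj₂ (≈-trans (i*[i*x]≈-x _) (-‿cong e))
    ... | inj₂ e = inj₁ (≈-trans (i*[i*x]≈-x _) (≈-trans (-‿cong e) (-‿involutive 1#)))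

    ipow-≈± : ∀ m n → parity m ≡ parity n → ipow m ≈± ipow n
    ipow-≈± m n m≡n = ≈±-resp (ipow-ratio m n) ≈-refl (≈±1-scale (ipow n) (ipow-even (m ℕ.+ n ℕ.* 3) even))
      where
      even : parity (m ℕ.+ n ℕ.* 3) ≡ 0ℙ
      even = trans (ℙ.+-homo-+ m (n ℕ.* 3))
                   (trans (cong₂ ℙ._+_ m≡n (trans (ℙ.*-homo-* n 3) (ℙ.*-identityʳ (parity n))))
                          (ℙ.p+p≡0ℙ (parity n)))

  Δ₀Δ₀Δ₁Δ₁≈singleton : ∀ x₁ x₂ x₃ x₄ →
    Δ₀ x₁ * (Δ₀ x₂ * (Δ₁ x₃ * Δ₁ x₄)) ≈ boolVal (inShape singleton (x₁ ∷ x₂ ∷ x₃ ∷ x₄ ∷ []))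
  Δ₀Δ₀Δ₁Δ₁≈singleton true  _     _     _     = zeroˡ _
  Δ₀Δ₀Δ₁Δ₁≈singleton false true  _     _     = ≈-trans (*-identityˡ _) (zeroˡ _)
  Δ₀Δ₀Δ₁Δ₁≈singleton false false false _     = ≈-trans (*-identityˡ _) (≈-trans (*-identityˡ _) (zeroˡ _))
  Δ₀Δ₀Δ₁Δ₁≈singleton false false true  false = ≈-trans (*-identityˡ _) (≈-trans (*-identityˡ _) (*-identityˡ _))
  Δ₀Δ₀Δ₁Δ₁≈singleton false false true  true  = ≈-trans (*-identityˡ _) (≈-trans (*-identityˡ _) (*-identityˡ _))

  module OverField (1≉0 : ¬ 1# ≈ 0#) (inverse : ∀ x → ¬ x ≈ 0# → ∃[ y ] x * y ≈ 1#) (i*i≈-1 : i * i ≈ - 1#) where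
    open Powers i*i≈-1

    module AffineForm {r} (g : Signature r) (lam : Carrier) (lam≉0 : ¬ lam ≈ 0#) (σ : Bits r → Bool) (k : Bits r → ℕ)
                      (g≈ : HasForm g lam σ k) where

      g-at : ∀ {x b} → σ x ≡ b → g x ≈ lam * (boolVal b * ipow (k x))
      g-at {x} e = subst (λ b → g x ≈ lam * (boolVal b * ipow (k x))) e (g≈ x)

      g-on : ∀ {x} → σ x ≡ true → g x ≈ lam * ipow (k x)
      g-on e = ≈-trans (g-at e) (*-congˡ (*-identityˡ _))

      g-off : ∀ {x} → σ x ≡ false → g x ≈ 0#
      g-off e = ≈-trans (g-at e) (≈-trans (*-congˡ (zeroˡ _)) (zeroʳ lam))

      g-on-nonzero : ∀ {x} → σ x ≡ true → ¬ g x ≈ 0#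
      g-on-nonzero {x} e gx≈0 =
        *-nonzero R inverse lam≉0 (ipow-nonzero 1≉0 (k x)) (≈-trans (≈-sym (g-on e)) gx≈0)

      in-support : ∀ {x} → InSu g x → σ x ≡ true
      in-support {x} gx≉0 with σ x in e
      ... | true  = refl
      ... | false = ⊥-elim (gx≉0 (g-off e))

      ratio : ∀ x y → InSu g x → InSu g y → RatioIn (g x) (g y)
      ratio x y gx≉0 gy≉0 with ratioIn-ipow lam (k x) (k y)
      ... | u , unit , e = u , unit ,
        ≈-trans (g-on (in-support gx≉0)) (≈-trans e (*-congˡ (≈-sym (g-on (in-support gy≉0)))))

      g*g : ∀ {x y} → σ x ≡ true → σ y ≡ true → g x * g y ≈ (lam * lam) * ipow (k x ℕ.+ k y)
      g*g {x} {y} σx σy = ≈-trans (*-cong (g-on σx) (g-on σy))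
        (≈-trans (interchange lam (ipow (k x)) lam (ipow (k y))) (*-congˡ (≈-sym (ipow-+ (k x) (k y)))))

    module Normal (g : Signature 4) (lam : Carrier) (lam≉0 : ¬ lam ≈ 0#) (k : Bits 4 → ℕ) where

      NormalAt : Shape → Set ℓ
      NormalAt sh = HasForm g lam (inShape sh) k

      module Shaped (sh : Shape) (g≈ : NormalAt sh) where
        open AffineForm g lam lam≉0 (inShape sh) k g≈ public

        support⇔ : ∀ x → InSu g x ⇔ x ∈ shapeSupport sh
        support⇔ x = mk⇔ (λ gx≉0 → decidable-stable (x ∈? shapeSupport sh) (gx≉0 ∘ g-off ∘ dec-false (x ∈? _)))
                         (g-on-nonzero ∘ dec-true (x ∈? _))

        suCard : SuCard g (length (shapeSupport sh))
        suCard = shapeSupport sh , refl , shapeSupport-unique sh , support⇔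

      singletonCase : NormalAt singleton → Case1 g
      singletonCase g≈ = suCard , g b0011 , g-on-nonzero refl , λ x₁ x₂ x₃ x₄ →
        ≈-trans (indicator (x₁ ∷ x₂ ∷ x₃ ∷ x₄ ∷ [])) (*-congˡ (≈-sym (Δ₀Δ₀Δ₁Δ₁≈singleton x₁ x₂ x₃ x₄)))
        where
        open Shaped singleton g≈
        indicator : ∀ x → g x ≈ g b0011 * boolVal (inShape singleton x)
        indicator x with inShape singleton x in e
        ... | false = ≈-trans (g-off e) (≈-sym (zeroʳ _))
        ... | true with Equivalence.to (support⇔ x) (g-on-nonzero e)
        ...   | here refl = ≈-sym (*-identityʳ _)

      pinnedPairCase : NormalAt pinnedPair → Case2 g
      pinnedPairCase g≈ = suCard , g b0101 , g b0110 , *-nonzero R inverse (g-on-nonzero refl) (g-on-nonzero refl) ,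
                          ratio b0101 b0110 (g-on-nonzero refl) (g-on-nonzero refl) ,
                          inj₁ (h , (false ∷ true ∷ [] , refl , refl , ≈-refl , ≈-refl , h-off) , factor)
        where
        open Shaped pinnedPair g≈
        h : Signature 2
        h y = g (false ∷ true ∷ y)
        h-off : ∀ y → y ≢ false ∷ true ∷ [] → y ≢ comp (false ∷ true ∷ []) → h y ≈ 0#
        h-off (false ∷ false ∷ []) _   _   = g-off refl
        h-off (true  ∷ true  ∷ []) _   _   = g-off refl
        h-off (false ∷ true  ∷ []) y≢α _   = ⊥-elim (y≢α refl)
        h-off (true  ∷ false ∷ []) _   y≢ᾱ = ⊥-elim (y≢ᾱ refl)
        factor : ∀ x₁ x₂ x₃ x₄ → g (x₁ ∷ x₂ ∷ x₃ ∷ x₄ ∷ []) ≈ Δ₀ x₁ * (Δ₁ x₂ * h (x₃ ∷ x₄ ∷ []))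
        factor false true  _ _ = ≈-sym (≈-trans (*-identityˡ _) (*-identityˡ _))
        factor false false _ _ = ≈-trans (g-off refl) (≈-sym (≈-trans (*-identityˡ _) (zeroˡ _)))
        factor true  _     _ _ = ≈-trans (g-off refl) (≈-sym (zeroˡ _))

      complementPairCase : NormalAt complementPair → Case2 g
      complementPairCase g≈ = suCard , g b0011 , g b1100 , *-nonzero R inverse (g-on-nonzero refl) (g-on-nonzero refl) ,
                              ratio b0011 b1100 (g-on-nonzero refl) (g-on-nonzero refl) ,
                              inj₂ (b0011 , refl , refl , ≈-refl , ≈-refl , off)
        where
        open Shaped complementPair g≈
        off : ∀ y → y ≢ b0011 → y ≢ comp b0011 → g y ≈ 0#
        off y y≢α y≢ᾱ = g-off (dec-false (y ∈? shapeSupport complementPair)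
          λ { (here y≡α) → y≢α y≡α ; (there (here y≡ᾱ)) → y≢ᾱ y≡ᾱ })

      twoComplementPairsCase : NormalAt twoComplementPairs →
        ComplementParity k → Case3 g
      twoComplementPairsCase g≈ k-parity =
        suCard , b0011 , b0101 , (λ ()) , (λ x → ∈-four ⇔-∘ support⇔ x) , ratio , products
        where
        open Shaped twoComplementPairs g≈
        products : g b0011 * g b1100 ≈± g b0101 * g b1010
        products = ≈±-resp (g*g refl refl) (g*g refl refl)
          (*-congˡ-≈± (lam * lam) (ipow-≈± (k b0011 ℕ.+ k b1100) (k b0101 ℕ.+ k b1010) (k-parity b0011 b0101)))

      normalCases : ∀ sh → NormalAt sh → ComplementParity k →
                    Case1 g ⊎ Case2 g ⊎ Case3 g
      normalCases singleton          g≈ _        = inj₁ (singletonCase g≈)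
      normalCases pinnedPair         g≈ _        = inj₂ (inj₁ (pinnedPairCase g≈))
      normalCases complementPair     g≈ _        = inj₂ (inj₁ (complementPairCase g≈))
      normalCases twoComplementPairs g≈ k-parity = inj₂ (inj₂ (twoComplementPairsCase g≈ k-parity))

lemma4p3 : ∀ {c ℓ} (R : CommutativeRing c ℓ) (i : CommutativeRing.Carrier R) →
    let open CommutativeRing R
        open Sig R i
    in ¬ (1# ≈ 0#) →
       (∀ x → ¬ (x ≈ 0#) → ∃[ y ] x * y ≈ 1#) →
       i * i ≈ - 1# →
       (f : Signature 4) → InA f → IsEO f → ¬ (∀ x → f x ≈ 0#) →
       ∃[ π ] (Case1 (reorder π f) ⊎ Case2 (reorder π f) ⊎ Case3 (reorder π f))
lemma4p3 R i 1≉0 inverse i*i≈-1 f (lam , _ , _ , A , αs , f≈) eo f≢0 =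
  π , normalCases (reorder π f) lam lam≉0 (k ∘ permuteBits π) sh g≈ (complementParity-expSum αs π)
  where
  open CommutativeRing R hiding (refl; sym; trans)
  open CommutativeRing R using () renaming (trans to ≈-trans)
  open Sig R i using (reorder)
  open SignatureFacts R i
  open OverField 1≉0 inverse i*i≈-1
  open Normal using (normalCases)

  s : Bits 4 → Bool
  s x = allZero A (extend x)

  k : Bits 4 → ℕ
  k x = expSum αs (extend x)

  lam≉0 : ¬ lam ≈ 0#
  lam≉0 lam≈0 = f≢0 λ x → ≈-trans (f≈ x) (≈-trans (*-congʳ lam≈0) (zeroˡ _))

  open AffineForm f lam lam≉0 s k f≈ using (g-off; g-on-nonzero)

  normal : ∃ (Normalises s)
  normal = normalForm s (λ x sx → eo x (g-on-nonzero sx)) (allZero-extend-⊕₃ A) (λ empty → f≢0 (g-off ∘ empty))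

  π = proj₁ (proj₁ normal)
  sh = proj₂ (proj₁ normal)

  g≈ : HasForm (reorder π f) lam (inShape sh) (k ∘ permuteBits π)
  g≈ = HasForm-resp-≗ {k = k ∘ permuteBits π} (proj₂ normal) (f≈ ∘ permuteBits π)
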